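{- Let $v,k$ be positive integers with $v\mid k^2$ and $k\mid v$, and let $\lambda=k^2/v$. Let $X=(x_t)_{t=0}^{v-1}$ be the binary sequence with $x_t=1$ for $0\le t\le k-1$ and $x_t=0$ for $k\le t\le v-1$. Let $Y=(y_t)_{t=0}^{v-1}$ be any binary sequence such that $y_{t+k}=y_t$ for all $t$ (indices modulo $v$) and such that $y_0y_1\ldots y_{k-1}$ has exactly $\lambda$ ones. Let $A_X,A_Y\subseteq\mathbb{Z}_v$ be the sets of positions of the ones of $X$ and $Y$ respectively. Then $\{A_X,A_Y\}$ is a $(v,2,k,\lambda)$-PSEDF in $\mathbb{Z}_v$ and a non-disjoint $(v,2,k,\lambda)$-SEDF in $\mathbb{Z}_v$.
   Context: Groups are written additively. For subsets $A,B$ of a group $G$, $\Delta(A,B)$ denotes the multiset $\{a-b: a\in A, b\in B\}$. For a group $G$ of order $v$ and $m>1$, a family of $k$-subsets $\{A_1,\ldots,A_m\}$ of $G$ is a $(v,m,k,\lambda)$-PSEDF if for every pair $i\neq j$ the multiset $\Delta(A_i,A_j)$ contains every element of $G$ exactly $\lambda$ times. It is a non-disjoint $(v,m,k,\lambda)$-SEDF if for each $i$ the multiset union $\bigcup_{j\neq i}\Delta(A_i,A_j)$ contains every element of $G$ (including $0$) exactly $\lambda$ times. -}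

module Defs where

open import Data.Nat using (ℕ; zero; suc; _+_; _*_; _∸_; _<_; NonZero)
open import Data.Nat.DivMod using (_%_; m%n<n)
open import Data.Bool using (Bool; true; false; _∧_)
import Data.Bool.Properties as BP
open import Data.Fin using (Fin; toℕ; fromℕ<)
import Data.Fin
import Data.Fin.Properties as FP
open import Data.List using (List; length; filter; allFin; cartesianProduct)
open import Data.Product using (_×_; _,_; proj₁; proj₂)
open import Relation.Nullary using (¬_; ¬?; _×-dec_)
open import Data.Nat.ListAction using (sum)
import Data.List
open import Relation.Binary.PropositionalEquality using (_≡_)

-- ℤ_v is modelled as Fin v (v ≥ 1), with residues 0..v-1.
-- A subset of ℤ_v is given by its indicator Fin v → Bool
-- (i.e. the binary sequence whose ones are at the positions of the subset).
Subset : ℕ → Set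
Subset v = Fin v → Bool

sub : {v : ℕ} .{{_ : NonZero v}} → Fin v → Fin v → Fin v
sub {v} a b = fromℕ< (m%n<n (toℕ a + (v ∸ toℕ b)) v)

add : {v : ℕ} .{{_ : NonZero v}} → Fin v → Fin v → Fin v
add {v} a b = fromℕ< (m%n<n (toℕ a + toℕ b) v)

fromNat : {v : ℕ} .{{_ : NonZero v}} → ℕ → Fin v
fromNat {v} t = fromℕ< (m%n<n t v)

card : {v : ℕ} → Subset v → ℕ
card {v} A = length (filter (λ a → A a BP.≟ true) (allFin v))

-- multiplicity of g in the multiset Δ(A,B) = {a - b : a ∈ A, b ∈ B}
multΔ : {v : ℕ} .{{_ : NonZero v}} → Subset v → Subset v → Fin v → ℕ
multΔ {v} A B g =
  length (filter (λ p → ((A (proj₁ p) ∧ B (proj₂ p)) BP.≟ true)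
                        ×-dec (sub (proj₁ p) (proj₂ p) FP.≟ g))
                 (cartesianProduct (allFin v) (allFin v)))

multΔUnion : {v m : ℕ} .{{_ : NonZero v}} → (Fin m → Subset v) → Fin m → Fin v → ℕ
multΔUnion {v} {m} A i g =
  sum (Data.List.map (λ j → multΔ (A i) (A j) g)
         (filter (λ j → ¬? (j FP.≟ i)) (allFin m)))

IsPSEDF : (v m k λ′ : ℕ) .{{_ : NonZero v}} → (Fin m → Subset v) → Set
IsPSEDF v m k λ′ A =
  (1 Data.Nat.< m)
  × (∀ i → card (A i) ≡ k)
  × (∀ i j → ¬ (i ≡ j) → ∀ g → multΔ (A i) (A j) g ≡ λ′)
  where import Data.Nat

IsNDSEDF : (v m k λ′ : ℕ) .{{_ : NonZero v}} → (Fin m → Subset v) → Set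
IsNDSEDF v m k λ′ A =
  (1 Data.Nat.< m)
  × (∀ i → card (A i) ≡ k)
  × (∀ i g → multΔUnion A i g ≡ λ′)
  where import Data.Nat

pair : {v : ℕ} → Subset v → Subset v → Fin 2 → Subset v
pair A B Data.Fin.zero = A
pair A B (Data.Fin.suc _) = B

onesPrefix : {v : ℕ} → ℕ → Subset v → ℕ
onesPrefix {v} k Y =
  length (filter (λ t → ((toℕ t Data.Nat.<ᵇ k) ∧ Y t) BP.≟ true) (allFin v))

{-# OPTIONS --safe #-}
-- Writing [b] for the Iverson bracket, Δ(A,B)(g) = Σ_a [A a ∧ B (a - g)] = Σ_b [A (g + b) ∧ B b].
-- As A_X = {0, …, k-1}, both Δ(A_X,A_Y)(g) and Δ(A_Y,A_X)(g) therefore count the ones of Y in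
-- k consecutive positions; since Y has period k every such window holds as many ones as
-- y_0 … y_{k-1}, namely λ. Tiling ℤ_v by v/k windows gives |A_Y| = (v/k)λ = k. For a pair of
-- sets the non-disjoint SEDF condition coincides with the PSEDF condition.
module Submission where

open import Defs
open import Data.Nat using (ℕ; suc; _*_; _+_; _<_; _<ᵇ_; NonZero)
open import Data.Nat.DivMod using (_/_)
open import Data.Nat.Divisibility using (_∣_)
open import Data.Bool using (Bool; true; false)
open import Data.Fin using (Fin; toℕ)
open import Data.Product using (_×_)
open import Relation.Binary.PropositionalEquality using (_≡_)

open import Data.Nat using (zero; _∸_; _≤_; s≤s; z≤n)
open import Data.Nat.Properties
open import Data.Nat.DivMod using (_%_; m%n<n; m%n%n≡m%n; %-distribˡ-+; [m+n]%n≡m%n; m<n⇒m%n≡m; m*n/n≡m)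
open import Data.Nat.Divisibility using (divides; ∣⇒≤)
open import Data.Bool using (_∧_)
import Data.Bool.Properties as BP
open import Data.Fin using () renaming (zero to fzero; suc to fsuc)
import Data.Fin.Properties as FP
open import Data.List using (_++_; map; filter; length; tabulate; cartesianProduct)
import Data.List.Properties as LP
open import Data.Product using (_,_; proj₁; proj₂)
open import Relation.Nullary using (does; ¬_; _×-dec_)
open import Relation.Nullary.Decidable using (does-⇔)
open import Relation.Unary using (Pred; Decidable)
open import Relation.Binary.PropositionalEquality using (refl; sym; trans; cong; cong₂; subst; module ≡-Reasoning)
open import Data.Empty using (⊥-elim)
open import Function using (_∘_; id; _⇔_; mk⇔; Equivalence)
open Equivalence using (to; from)
open import Algebra.Properties.CommutativeMonoid.Sum +-0-commutativeMonoid
  using (sum-syntax; sum-cong-≗; ∑-comm; sum-replicate-zero)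

open ≡-Reasoning

iverson : Bool → ℕ
iverson true  = 1
iverson false = 0

iverson-∧ : ∀ x y → iverson (x ∧ y) ≡ iverson x * iverson y
iverson-∧ true  true  = refl
iverson-∧ true  false = refl
iverson-∧ false y     = refl

iverson-≟-true : ∀ x → iverson (does (x BP.≟ true)) ≡ iverson x
iverson-≟-true true  = refl
iverson-≟-true false = refl

∑-one : ∀ n → ∑[ i < n ] 1 ≡ n
∑-one zero    = refl
∑-one (suc n) = cong suc (∑-one n)

∑-delta : ∀ {n} (f : Fin n → ℕ) (c : Fin n) → ∑[ i < n ] (iverson (does (i FP.≟ c)) * f i) ≡ f c
∑-delta {suc n} f fzero    = begin
  f fzero + 0 + ∑[ i < n ] 0 ≡⟨ cong₂ _+_ (+-identityʳ (f fzero)) (sum-replicate-zero n) ⟩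
  f fzero + 0                 ≡⟨ +-identityʳ (f fzero) ⟩
  f fzero                     ∎
∑-delta {suc n} f (fsuc c) = ∑-delta (f ∘ fsuc) c

∑-last : ∀ n (f : ℕ → ℕ) → ∑[ i < suc n ] f (toℕ i) ≡ ∑[ i < n ] f (toℕ i) + f n
∑-last zero    f = +-comm (f 0) 0
∑-last (suc n) f = trans (cong (f 0 +_) (∑-last n (f ∘ suc))) (sym (+-assoc (f 0) _ _))

∑-++ : ∀ m n (f : ℕ → ℕ) → ∑[ i < m + n ] f (toℕ i) ≡ ∑[ i < m ] f (toℕ i) + ∑[ i < n ] f (m + toℕ i)
∑-++ zero    n f = refl
∑-++ (suc m) n f = trans (cong (f 0 +_) (∑-++ m n (f ∘ suc))) (sym (+-assoc (f 0) _ _))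

∑-<ᵇ : ∀ {k n} (b : ℕ → Bool) → k ≤ n →
  ∑[ i < n ] iverson ((toℕ i <ᵇ k) ∧ b (toℕ i)) ≡ ∑[ i < k ] iverson (b (toℕ i))
∑-<ᵇ {zero}  {n}     b _         = sum-replicate-zero n
∑-<ᵇ {suc k} {suc n} b (s≤s k≤n) = cong (iverson (b 0) +_) (∑-<ᵇ (b ∘ suc) k≤n)

length-filter-tabulate : ∀ {a p n} {A : Set a} {P : Pred A p} (P? : Decidable P) (f : Fin n → A) →
  length (filter P? (tabulate f)) ≡ ∑[ i < n ] iverson (does (P? (f i)))
length-filter-tabulate {n = zero}  P? f = refl
length-filter-tabulate {n = suc n} P? f with does (P? (f fzero))
... | true  = cong suc (length-filter-tabulate P? (f ∘ fsuc))
... | false = length-filter-tabulate P? (f ∘ fsuc)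

length-filter-cartesianProduct : ∀ {a b p m n} {A : Set a} {B : Set b} {P : Pred (A × B) p}
  (P? : Decidable P) (f : Fin m → A) (h : Fin n → B) →
  length (filter P? (cartesianProduct (tabulate f) (tabulate h)))
    ≡ ∑[ i < m ] ∑[ j < n ] iverson (does (P? (f i , h j)))
length-filter-cartesianProduct {m = zero}  P? f h = refl
length-filter-cartesianProduct {m = suc m} {n} P? f h = begin
  length (filter P? (row ++ rest))                ≡⟨ cong length (LP.filter-++ P? row rest) ⟩
  length (filter P? row ++ filter P? rest)        ≡⟨ LP.length-++ (filter P? row) ⟩
  length (filter P? row) + length (filter P? rest)
    ≡⟨ cong₂ _+_ (trans (cong (length ∘ filter P?) (LP.map-tabulate h (f fzero ,_)))
                         (length-filter-tabulate P? (λ j → f fzero , h j)))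
                  (length-filter-cartesianProduct P? (f ∘ fsuc) h) ⟩
  ∑[ j < n ] iverson (does (P? (f fzero , h j)))
    + ∑[ i < m ] ∑[ j < n ] iverson (does (P? (f (fsuc i) , h j))) ∎
  where
  row  = map (f fzero ,_) (tabulate h)
  rest = cartesianProduct (tabulate (f ∘ fsuc)) (tabulate h)

module _ {v : ℕ} .{{_ : NonZero v}} where

  toℕ-fromNat : ∀ n → toℕ (fromNat {v} n) ≡ n % v
  toℕ-fromNat n = FP.toℕ-fromℕ< (m%n<n n v)

  fromNat-cong-% : ∀ {m n} → m % v ≡ n % v → fromNat {v} m ≡ fromNat n
  fromNat-cong-% {m} {n} eq = FP.toℕ-injective (begin
    toℕ (fromNat m) ≡⟨ toℕ-fromNat m ⟩
    m % v           ≡⟨ eq ⟩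
    n % v           ≡⟨ toℕ-fromNat n ⟨
    toℕ (fromNat n) ∎)

  fromNat-toℕ : ∀ (i : Fin v) → fromNat (toℕ i) ≡ i
  fromNat-toℕ i = FP.toℕ-injective (trans (toℕ-fromNat (toℕ i)) (m<n⇒m%n≡m (FP.toℕ<n i)))

  fromNat-+v : ∀ n → fromNat {v} (n + v) ≡ fromNat n
  fromNat-+v n = fromNat-cong-% ([m+n]%n≡m%n n v)

  fromNat-toℕ-+ : ∀ m n → fromNat {v} (toℕ (fromNat {v} m) + n) ≡ fromNat (m + n)
  fromNat-toℕ-+ m n = fromNat-cong-% (begin
    (toℕ (fromNat m) + n) % v         ≡⟨ cong (λ x → (x + n) % v) (toℕ-fromNat m) ⟩
    (m % v + n) % v                   ≡⟨ %-distribˡ-+ (m % v) n v ⟩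
    (m % v % v + n % v) % v           ≡⟨ cong (λ x → (x + n % v) % v) (m%n%n≡m%n m v) ⟩
    (m % v + n % v) % v               ≡⟨ %-distribˡ-+ m n v ⟨
    (m + n) % v                       ∎)

  add-fromNat : ∀ m n → add (fromNat {v} m) (fromNat n) ≡ fromNat (m + n)
  add-fromNat m n = fromNat-cong-% (begin
    (toℕ (fromNat m) + toℕ (fromNat n)) % v ≡⟨ cong₂ (λ x y → (x + y) % v) (toℕ-fromNat m) (toℕ-fromNat n) ⟩
    (m % v + n % v) % v                     ≡⟨ %-distribˡ-+ m n v ⟨
    (m + n) % v                             ∎)

  add-comm : ∀ (a b : Fin v) → add a b ≡ add b a
  add-comm a b = cong fromNat (+-comm (toℕ a) (toℕ b))

  add-sub : ∀ (a b : Fin v) → add (sub a b) b ≡ a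
  add-sub a b = begin
    fromNat (toℕ (fromNat (toℕ a + (v ∸ toℕ b))) + toℕ b) ≡⟨ fromNat-toℕ-+ (toℕ a + (v ∸ toℕ b)) (toℕ b) ⟩
    fromNat (toℕ a + (v ∸ toℕ b) + toℕ b)                 ≡⟨ cong fromNat (+-assoc (toℕ a) (v ∸ toℕ b) (toℕ b)) ⟩
    fromNat (toℕ a + (v ∸ toℕ b + toℕ b))                 ≡⟨ cong (fromNat ∘ (toℕ a +_)) (m∸n+n≡m (<⇒≤ (FP.toℕ<n b))) ⟩
    fromNat (toℕ a + v)                                   ≡⟨ fromNat-+v (toℕ a) ⟩
    fromNat (toℕ a)                                       ≡⟨ fromNat-toℕ a ⟩
    a                                                     ∎

  sub-add : ∀ (a b : Fin v) → sub (add a b) b ≡ a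
  sub-add a b = begin
    fromNat (toℕ (fromNat (toℕ a + toℕ b)) + (v ∸ toℕ b)) ≡⟨ fromNat-toℕ-+ (toℕ a + toℕ b) (v ∸ toℕ b) ⟩
    fromNat (toℕ a + toℕ b + (v ∸ toℕ b))                 ≡⟨ cong fromNat (+-assoc (toℕ a) (toℕ b) (v ∸ toℕ b)) ⟩
    fromNat (toℕ a + (toℕ b + (v ∸ toℕ b)))               ≡⟨ cong (fromNat ∘ (toℕ a +_)) (m+[n∸m]≡n (<⇒≤ (FP.toℕ<n b))) ⟩
    fromNat (toℕ a + v)                                   ≡⟨ fromNat-+v (toℕ a) ⟩
    fromNat (toℕ a)                                       ≡⟨ fromNat-toℕ a ⟩
    a                                                     ∎

  sub≡⇔≡add : ∀ {a b g : Fin v} → (sub a b ≡ g) ⇔ (a ≡ add g b)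
  sub≡⇔≡add {a} {b} = mk⇔ (λ { refl → sym (add-sub a b) }) (λ { refl → sub-add _ b })

  sub≡⇔sub≡ : ∀ {a b g : Fin v} → (sub a b ≡ g) ⇔ (b ≡ sub a g)
  sub≡⇔sub≡ {a} {b} {g} = mk⇔ to′ (λ { refl → from sub≡⇔≡add (trans (sym (add-sub a g)) (add-comm _ g)) })
    where
    to′ : sub a b ≡ g → b ≡ sub a g
    to′ eq = begin
      b               ≡⟨ sub-add b g ⟨
      sub (add b g) g ≡⟨ cong (λ x → sub x g) (add-comm b g) ⟩
      sub (add g b) g ≡⟨ cong (λ x → sub x g) (to sub≡⇔≡add eq) ⟨
      sub a g         ∎

  module _ (A B : Subset v) (g : Fin v) where

    multΔ≡∑∑ : multΔ A B g ≡ ∑[ a < v ] ∑[ b < v ] (iverson (does (sub a b FP.≟ g)) * iverson (A a ∧ B b))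
    multΔ≡∑∑ = begin
      multΔ A B g
        ≡⟨ length-filter-cartesianProduct (λ p → ((A (proj₁ p) ∧ B (proj₂ p)) BP.≟ true) ×-dec (sub (proj₁ p) (proj₂ p) FP.≟ g)) id id ⟩
      ∑[ a < v ] ∑[ b < v ] iverson (does ((A a ∧ B b) BP.≟ true) ∧ does (sub a b FP.≟ g))
        ≡⟨ sum-cong-≗ (λ a → sum-cong-≗ (λ b → summand a b)) ⟩
      ∑[ a < v ] ∑[ b < v ] (iverson (does (sub a b FP.≟ g)) * iverson (A a ∧ B b)) ∎
      where
      summand : ∀ a b → iverson (does ((A a ∧ B b) BP.≟ true) ∧ does (sub a b FP.≟ g))
                        ≡ iverson (does (sub a b FP.≟ g)) * iverson (A a ∧ B b)
      summand a b = begin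
        iverson (does ((A a ∧ B b) BP.≟ true) ∧ does (sub a b FP.≟ g))
          ≡⟨ iverson-∧ (does ((A a ∧ B b) BP.≟ true)) _ ⟩
        iverson (does ((A a ∧ B b) BP.≟ true)) * iverson (does (sub a b FP.≟ g))
          ≡⟨ cong (_* _) (iverson-≟-true (A a ∧ B b)) ⟩
        iverson (A a ∧ B b) * iverson (does (sub a b FP.≟ g))
          ≡⟨ *-comm (iverson (A a ∧ B b)) _ ⟩
        iverson (does (sub a b FP.≟ g)) * iverson (A a ∧ B b) ∎

    multΔ≡∑ˡ : multΔ A B g ≡ ∑[ a < v ] iverson (A a ∧ B (sub a g))
    multΔ≡∑ˡ = begin
      multΔ A B g
        ≡⟨ multΔ≡∑∑ ⟩
      ∑[ a < v ] ∑[ b < v ] (iverson (does (sub a b FP.≟ g)) * iverson (A a ∧ B b))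
        ≡⟨ sum-cong-≗ (λ a → sum-cong-≗ (λ b →
             cong (λ d → iverson d * iverson (A a ∧ B b)) (does-⇔ sub≡⇔sub≡ (sub a b FP.≟ g) (b FP.≟ sub a g)))) ⟩
      ∑[ a < v ] ∑[ b < v ] (iverson (does (b FP.≟ sub a g)) * iverson (A a ∧ B b))
        ≡⟨ sum-cong-≗ (λ a → ∑-delta (λ b → iverson (A a ∧ B b)) (sub a g)) ⟩
      ∑[ a < v ] iverson (A a ∧ B (sub a g)) ∎

    multΔ≡∑ʳ : multΔ A B g ≡ ∑[ b < v ] iverson (A (add g b) ∧ B b)
    multΔ≡∑ʳ = begin
      multΔ A B g
        ≡⟨ multΔ≡∑∑ ⟩
      ∑[ a < v ] ∑[ b < v ] (iverson (does (sub a b FP.≟ g)) * iverson (A a ∧ B b))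
        ≡⟨ ∑-comm (λ a b → iverson (does (sub a b FP.≟ g)) * iverson (A a ∧ B b)) ⟩
      ∑[ b < v ] ∑[ a < v ] (iverson (does (sub a b FP.≟ g)) * iverson (A a ∧ B b))
        ≡⟨ sum-cong-≗ (λ b → sum-cong-≗ (λ a →
             cong (λ d → iverson d * iverson (A a ∧ B b)) (does-⇔ sub≡⇔≡add (sub a b FP.≟ g) (a FP.≟ add g b)))) ⟩
      ∑[ b < v ] ∑[ a < v ] (iverson (does (a FP.≟ add g b)) * iverson (A a ∧ B b))
        ≡⟨ sum-cong-≗ (λ b → ∑-delta (λ a → iverson (A a ∧ B b)) (add g b)) ⟩
      ∑[ b < v ] iverson (A (add g b) ∧ B b) ∎

  card≡∑ : (A : Subset v) → card A ≡ ∑[ a < v ] iverson (A a)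
  card≡∑ A = trans (length-filter-tabulate (λ a → A a BP.≟ true) id) (sum-cong-≗ (λ a → iverson-≟-true (A a)))

module Periodic (G : ℕ → ℕ) (k : ℕ) (G-periodic : ∀ n → G (n + k) ≡ G n) where

  window : ℕ → ℕ
  window c = ∑[ t < k ] G (c + toℕ t)

  window-suc : ∀ c → window (suc c) ≡ window c
  window-suc c = +-cancelʳ-≡ (G c) (window (suc c)) (window c) (begin
    window (suc c) + G c                       ≡⟨ cong₂ _+_ window-suc-as-tail (cong G (sym (+-identityʳ c))) ⟩
    ∑[ t < k ] G (c + suc (toℕ t)) + G (c + 0) ≡⟨ +-comm _ (G (c + 0)) ⟩
    ∑[ t < suc k ] G (c + toℕ t)               ≡⟨ ∑-last k (G ∘ (c +_)) ⟩
    window c + G (c + k)                       ≡⟨ cong (window c +_) (G-periodic c) ⟩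
    window c + G c                             ∎)
    where
    window-suc-as-tail : window (suc c) ≡ ∑[ t < k ] G (c + suc (toℕ t))
    window-suc-as-tail = sum-cong-≗ {k} (λ t → cong G (sym (+-suc c (toℕ t))))

  window-const : ∀ c → window c ≡ window 0
  window-const zero    = refl
  window-const (suc c) = trans (window-suc c) (window-const c)

  ∑-periods : ∀ q c → ∑[ t < q * k ] G (c + toℕ t) ≡ q * window 0
  ∑-periods zero    c = refl
  ∑-periods (suc q) c = begin
    ∑[ t < k + q * k ] G (c + toℕ t)              ≡⟨ ∑-++ k (q * k) (G ∘ (c +_)) ⟩
    window c + ∑[ t < q * k ] G (c + (k + toℕ t)) ≡⟨ cong₂ _+_ (window-const c) shift-start ⟩
    window 0 + ∑[ t < q * k ] G (c + k + toℕ t)   ≡⟨ cong (window 0 +_) (∑-periods q (c + k)) ⟩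
    window 0 + q * window 0                       ∎
    where
    shift-start : ∑[ t < q * k ] G (c + (k + toℕ t)) ≡ ∑[ t < q * k ] G (c + k + toℕ t)
    shift-start = sum-cong-≗ {q * k} (λ t → cong G (sym (+-assoc c k (toℕ t))))

module PrefixAndPeriodic {v : ℕ} .{{_ : NonZero v}} (k : ℕ) (k≤v : k ≤ v) (X Y : Subset v)
  (X-prefix : ∀ t → X t ≡ (toℕ t <ᵇ k))
  (Y-periodic : ∀ t → Y (add t (fromNat k)) ≡ Y t) where

  Yₙ : ℕ → ℕ
  Yₙ n = iverson (Y (fromNat n))

  Yₙ-periodic : ∀ n → Yₙ (n + k) ≡ Yₙ n
  Yₙ-periodic n = begin
    iverson (Y (fromNat (n + k)))             ≡⟨ cong (iverson ∘ Y) (add-fromNat n k) ⟨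
    iverson (Y (add (fromNat n) (fromNat k))) ≡⟨ cong iverson (Y-periodic (fromNat n)) ⟩
    iverson (Y (fromNat n))                   ∎

  open Periodic Yₙ k Yₙ-periodic public

  prefix-window : ∀ c → ∑[ a < v ] iverson ((toℕ a <ᵇ k) ∧ Y (fromNat (c + toℕ a))) ≡ window 0
  prefix-window c = trans (∑-<ᵇ (λ n → Y (fromNat (c + n))) k≤v) (window-const c)

  onesPrefix≡window : onesPrefix k Y ≡ window 0
  onesPrefix≡window = begin
    onesPrefix k Y                                            ≡⟨ card≡∑ (λ a → (toℕ a <ᵇ k) ∧ Y a) ⟩
    ∑[ a < v ] iverson ((toℕ a <ᵇ k) ∧ Y a)                   ≡⟨ sum-cong-≗ {v} (λ a → cong (λ y → iverson ((toℕ a <ᵇ k) ∧ Y y)) (sym (fromNat-toℕ a))) ⟩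
    ∑[ a < v ] iverson ((toℕ a <ᵇ k) ∧ Y (fromNat (toℕ a))) ≡⟨ prefix-window 0 ⟩
    window 0                                                  ∎

  X-window : ∀ c → ∑[ a < v ] iverson (X a ∧ Y (fromNat (c + toℕ a))) ≡ window 0
  X-window c = trans (sum-cong-≗ {v} (λ a → cong (λ x → iverson (x ∧ Y (fromNat (c + toℕ a)))) (X-prefix a)))
                     (prefix-window c)

  card-X : card X ≡ k
  card-X = begin
    card X                                          ≡⟨ card≡∑ X ⟩
    ∑[ a < v ] iverson (X a)                        ≡⟨ sum-cong-≗ {v} (λ a → cong iverson (trans (X-prefix a) (sym (BP.∧-identityʳ _)))) ⟩
    ∑[ a < v ] iverson ((toℕ a <ᵇ k) ∧ true)        ≡⟨ ∑-<ᵇ (λ _ → true) k≤v ⟩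
    ∑[ a < k ] 1                                    ≡⟨ ∑-one k ⟩
    k                                               ∎

  card-Y : ∀ q → v ≡ q * k → card Y ≡ q * window 0
  card-Y q v≡qk = begin
    card Y                         ≡⟨ card≡∑ Y ⟩
    ∑[ a < v ] iverson (Y a)       ≡⟨ sum-cong-≗ {v} (λ a → cong (iverson ∘ Y) (sym (fromNat-toℕ a))) ⟩
    ∑[ a < v ] Yₙ (toℕ a)          ≡⟨ subst (λ n → ∑[ a < n ] Yₙ (toℕ a) ≡ q * window 0) (sym v≡qk) (∑-periods q 0) ⟩
    q * window 0                   ∎

  multΔ-X-Y : ∀ g → multΔ X Y g ≡ window 0
  multΔ-X-Y g = begin
    multΔ X Y g                                                ≡⟨ multΔ≡∑ˡ X Y g ⟩
    ∑[ a < v ] iverson (X a ∧ Y (sub a g))                     ≡⟨ sum-cong-≗ {v} (λ a → cong (λ n → iverson (X a ∧ Y (fromNat n))) (+-comm (toℕ a) (v ∸ toℕ g))) ⟩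
    ∑[ a < v ] iverson (X a ∧ Y (fromNat (v ∸ toℕ g + toℕ a))) ≡⟨ X-window (v ∸ toℕ g) ⟩
    window 0                                                   ∎

  multΔ-Y-X : ∀ g → multΔ Y X g ≡ window 0
  multΔ-Y-X g = begin
    multΔ Y X g                                  ≡⟨ multΔ≡∑ʳ Y X g ⟩
    ∑[ b < v ] iverson (Y (add g b) ∧ X b)       ≡⟨ sum-cong-≗ {v} (λ b → cong iverson (BP.∧-comm (Y (add g b)) (X b))) ⟩
    ∑[ b < v ] iverson (X b ∧ Y (add g b))       ≡⟨ X-window (toℕ g) ⟩
    window 0                                     ∎

k*k≡l*v⇒v≡q*k⇒q*l≡k : ∀ {k v} l q .{{_ : NonZero k}} → k * k ≡ l * v → v ≡ q * k → q * l ≡ k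
k*k≡l*v⇒v≡q*k⇒q*l≡k {k} {v} l q k²≡lv v≡qk = *-cancelʳ-≡ (q * l) k k (begin
  q * l * k       ≡⟨ cong (_* k) (*-comm q l) ⟩
  l * q * k       ≡⟨ *-assoc l q k ⟩
  l * (q * k)     ≡⟨ cong (l *_) v≡qk ⟨
  l * v           ≡⟨ k²≡lv ⟨
  k * k           ∎)

module _ {v : ℕ} .{{_ : NonZero v}} {k λ′ : ℕ} (A B : Subset v)
  (card-A : card A ≡ k) (card-B : card B ≡ k)
  (multΔ-A-B : ∀ g → multΔ A B g ≡ λ′) (multΔ-B-A : ∀ g → multΔ B A g ≡ λ′) where

  private
    card-pair : ∀ i → card (pair A B i) ≡ k
    card-pair fzero    = card-A
    card-pair (fsuc _) = card-B

  pair-isPSEDF : IsPSEDF v 2 k λ′ (pair A B)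
  pair-isPSEDF = s≤s (s≤s z≤n) , card-pair , multΔ-pair
    where
    multΔ-pair : ∀ i j → ¬ i ≡ j → ∀ g → multΔ (pair A B i) (pair A B j) g ≡ λ′
    multΔ-pair fzero           fzero           i≢j = ⊥-elim (i≢j refl)
    multΔ-pair fzero           (fsuc fzero)    _   = multΔ-A-B
    multΔ-pair (fsuc fzero)    fzero           _   = multΔ-B-A
    multΔ-pair (fsuc fzero)    (fsuc fzero)    i≢j = ⊥-elim (i≢j refl)

  pair-isNDSEDF : IsNDSEDF v 2 k λ′ (pair A B)
  pair-isNDSEDF = s≤s (s≤s z≤n) , card-pair , multΔUnion-pair
    where
    multΔUnion-pair : ∀ i g → multΔUnion (pair A B) i g ≡ λ′
    multΔUnion-pair fzero        g = trans (+-identityʳ _) (multΔ-A-B g)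
    multΔUnion-pair (fsuc fzero) g = trans (+-identityʳ _) (multΔ-B-A g)

mainTheorem5 : (v k : ℕ) → .{{_ : NonZero v}} → .{{_ : NonZero k}}
    → v ∣ k * k → k ∣ v
    → (X Y : Subset v)
    → (∀ (t : Fin v) → X t ≡ (toℕ t <ᵇ k))
    → (∀ (t : Fin v) → Y (add t (fromNat k)) ≡ Y t)
    → onesPrefix k Y ≡ (k * k) / v
    → IsPSEDF v 2 k ((k * k) / v) (pair X Y)
    × IsNDSEDF v 2 k ((k * k) / v) (pair X Y)
mainTheorem5 v k (divides λ′ k²≡λ′v) (divides q v≡qk) X Y X-prefix Y-periodic ones≡k²/v =
  pair-isPSEDF X Y card-X card-Y≡k multΔ-X-Y≡k²/v multΔ-Y-X≡k²/v ,
  pair-isNDSEDF X Y card-X card-Y≡k multΔ-X-Y≡k²/v multΔ-Y-X≡k²/v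
  where
  open PrefixAndPeriodic k (∣⇒≤ (divides q v≡qk)) X Y X-prefix Y-periodic

  window≡k²/v : window 0 ≡ (k * k) / v
  window≡k²/v = trans (sym onesPrefix≡window) ones≡k²/v

  multΔ-X-Y≡k²/v : ∀ g → multΔ X Y g ≡ (k * k) / v
  multΔ-X-Y≡k²/v g = trans (multΔ-X-Y g) window≡k²/v

  multΔ-Y-X≡k²/v : ∀ g → multΔ Y X g ≡ (k * k) / v
  multΔ-Y-X≡k²/v g = trans (multΔ-Y-X g) window≡k²/v

  k²/v≡λ′ : (k * k) / v ≡ λ′
  k²/v≡λ′ = trans (cong (_/ v) k²≡λ′v) (m*n/n≡m λ′ v)

  card-Y≡k : card Y ≡ k
  card-Y≡k = begin
    card Y          ≡⟨ card-Y q v≡qk ⟩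
    q * window 0    ≡⟨ cong (q *_) (trans window≡k²/v k²/v≡λ′) ⟩
    q * λ′          ≡⟨ k*k≡l*v⇒v≡q*k⇒q*l≡k λ′ q k²≡λ′v v≡qk ⟩
    k               ∎
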